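{- Consider the PDSTSP setting described in the context. For every subset $S \subseteq V_c$ with $|S| \geq 3$ and every $l \in S$, every feasible PDSTSP solution $(x,y)$ satisfies $$\sum_{i, j \in S:\, i<j} x_{ij} \leq \sum_{k \in S \setminus \{l\}} y_k .$$
   Context: Parallel Drone Scheduling Traveling Salesman Problem (PDSTSP). There is a complete undirected graph $G=(V,E)$ with $V=\{0,1,\dots,n,n+1\}$ and $E=\{(i,j): i,j\in V,\ i<j\}$. Vertex $0$ is the depot and vertex $n+1$ is a copy of the depot. The customers are $V_c=\{1,\dots,n\}$. A subset $V_d\subseteq V_c$ consists of drone-eligible customers, and $V_t=V_c\setminus V_d$ are the customers that must be served by the truck. The variables are binary $x_{ij}$ for edges $(i,j)\in E$ (equal to 1 if the truck travels edge $(i,j)$) and binary $y_i$ for $i \in V$ (equal to 1 if vertex $i$ is visited by the truck), with $y_0=y_{n+1}=1$. Each customer with $y_i=0$ is served by one of the drones via back-and-forth trips from the depot; the drone variables are irrelevant here. A pair $(x,y)$ is a feasible PDSTSP solution if: $y_i=1$ for all $i\in V_t$; and $x$ is the incidence vector of the edge set of a simple path in $G$ from $0$ to $n+1$ whose interior vertices are exactly the customers $i\in V_c$ with $y_i=1$. In particular, every customer $j$ satisfies $\sum_{i<j}x_{ij}+\sum_{k>j}x_{jk}=2y_j$. -}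

module Defs where

open import Data.Nat using (ℕ; zero; suc; _+_)
open import Data.Bool using (Bool; true; false; if_then_else_; _∧_; not)
open import Data.Fin using (Fin; zero; suc; fromℕ; inject₁; _<_; _<?_; _≟_)
open import Data.Fin.Subset using (Subset; _∈_; _∉_)
open import Data.List using (List; []; _∷_; _++_; [_]; map; allFin)
open import Data.Nat.ListAction using (sum)
open import Data.List.Relation.Unary.Unique.Propositional using (Unique)
import Data.List.Membership.Propositional as LM
open import Data.Vec using (lookup)
open import Data.Product using (Σ; _×_; ∃)
open import Data.Sum using (_⊎_)
open import Relation.Nullary using (¬_; does)
open import Relation.Binary.PropositionalEquality using (_≡_)

-- Vertex set V = {0, 1, ..., n, n+1}, represented as Fin (2 + n).
Vtx : ℕ → Set
Vtx n = Fin (suc (suc n))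

depot : ∀ {n} → Vtx n
depot = zero

depot′ : ∀ {n} → Vtx n
depot′ {n} = fromℕ (suc n)

-- customer i ∈ Fin n (0-based) is the vertex i+1 ∈ V_c = {1,...,n}
cust : ∀ {n} → Fin n → Vtx n
cust i = suc (inject₁ i)

data Consecutive {A : Set} : List A → A → A → Set where
  here  : ∀ {u v rest} → Consecutive (u ∷ v ∷ rest) u v
  there : ∀ {w p u v} → Consecutive p u v → Consecutive (w ∷ p) u v

OnPath : ∀ {n} → List (Vtx n) → Vtx n → Vtx n → Set
OnPath p u v = Consecutive p u v ⊎ Consecutive p v u

-- Feasible PDSTSP solution (x, y).  D is the set V_d of drone-eligible
-- customers; V_t = V_c \ V_d.  x i j (meaningful for i < j) and y i are
-- the 0/1 variables of the formulation.
record Feasible (n : ℕ) (D : Subset n) (x : Vtx n → Vtx n → ℕ) (y : Vtx n → ℕ) : Set where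
  field
    y-binary   : ∀ v → y v ≡ 0 ⊎ y v ≡ 1
    y-depot    : y depot ≡ 1
    y-depot′   : y depot′ ≡ 1
    y-truck    : ∀ i → i ∉ D → y (cust i) ≡ 1
    -- the interior vertices of the truck path
    interior   : List (Vtx n)
    simple     : Unique (depot ∷ interior ++ [ depot′ ])
    interior-sound    : ∀ v → v LM.∈ interior → Σ (Fin n) (λ i → v ≡ cust i × y v ≡ 1)
    interior-complete : ∀ i → y (cust i) ≡ 1 → cust i LM.∈ interior
    x-incidence : ∀ u v → u < v →
      (x u v ≡ 1 × OnPath (depot ∷ interior ++ [ depot′ ]) u v)
      ⊎ (x u v ≡ 0 × ¬ OnPath (depot ∷ interior ++ [ depot′ ]) u v)

sumFin : ∀ {n} → (Fin n → ℕ) → ℕ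
sumFin {n} f = sum (map f (allFin n))

edgeSum : ∀ {n} → Subset n → (Vtx n → Vtx n → ℕ) → ℕ
edgeSum S x = sumFin λ i → sumFin λ j →
  if lookup S i ∧ lookup S j ∧ does (i <? j) then x (cust i) (cust j) else 0

nodeSumExcept : ∀ {n} → Subset n → Fin n → (Vtx n → ℕ) → ℕ
nodeSumExcept S l y = sumFin λ k →
  if lookup S k ∧ not (does (k ≟ l)) then y (cust k) else 0

-- Orient every edge of the truck path away from the position t of l and charge the edge to its head,
-- i.e. to the endpoint farther from t.  An edge whose lower endpoint sits at position m is charged to
-- position away t m ∈ {m, m + 1}; as m ↦ away t m is injective and never hits t, distinct edges are
-- charged to distinct visited customers of S other than l, whose y-values are 1.
module Submission where

open import Defs
open import Data.Bool using (true; false; T; if_then_else_; _∧_; not)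
open import Data.Bool.Properties using (T-∧)
open import Data.Empty using (⊥; ⊥-elim)
open import Data.Fin as Fin using (Fin; toℕ)
import Data.Fin.Properties as Finₚ
open import Data.Fin.Subset using (Subset)
open import Data.Vec using (lookup)
open import Data.List using (List; []; _∷_; _++_; [_]; map; allFin; cartesianProduct)
open import Data.List.Properties using (map-++; map-∘)
open import Data.List.Membership.Propositional.Properties using (∈-allFin)
open import Data.List.Relation.Unary.AllPairs using (_∷_)
import Data.List.Relation.Unary.All as All
open import Data.List.Relation.Unary.Any as Any using (here; there)
open import Data.List.Relation.Unary.Unique.Propositional using (Unique)
open import Data.List.Relation.Unary.Unique.Propositional.Properties using (allFin⁺; cartesianProduct⁺)
open import Data.Nat as ℕ using (ℕ; zero; suc; _+_; _≤_; _<_; _≤?_; _⊓_; z≤n; s≤s)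
open import Data.Nat.ListAction using (sum)
open import Data.Nat.ListAction.Properties using (sum-++)
open import Data.Nat.Properties
  using ( +-assoc; +-comm; +-identityʳ; +-mono-≤; ≤-reflexive; <-irrefl; <-asym; <-≤-trans; ≰⇒>
        ; n<1+n; n≤1+n; suc-injective; m≤n⇒m⊓n≡m; m≥n⇒m⊓n≡n; module ≤-Reasoning)
open import Data.Product using (∃-syntax; _×_; _,_; proj₁; proj₂)
open import Data.Sum using (_⊎_; inj₁; inj₂)
open import Function using (_∘_)
open import Function.Bundles using (Equivalence)
open import Relation.Binary.Definitions using (DecidableEquality)
open import Relation.Binary.PropositionalEquality hiding ([_])
open import Relation.Nullary using (Dec; does; yes; no)

≡suc⇒≢0 : ∀ {k m : ℕ} → k ≡ suc m → k ≢ 0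
≡suc⇒≢0 refl ()

≤1⇒≤ : ∀ {n m : ℕ} → n ≤ 1 → (n ≢ 0 → 1 ≤ m) → n ≤ m
≤1⇒≤ z≤n       _   = z≤n
≤1⇒≤ (s≤s z≤n) 1≤m = 1≤m (λ ())

T-does : ∀ {P : Set} (d : Dec P) → T (does d) → P
T-does (yes p) _ = p

if-≢0 : ∀ b {v : ℕ} → (if b then v else 0) ≢ 0 → T b × v ≢ 0
if-≢0 true  v≢0 = _ , v≢0
if-≢0 false 0≢0 = ⊥-elim (0≢0 refl)

if-≤ : ∀ b {v m : ℕ} → (T b → v ≤ m) → (if b then v else 0) ≤ m
if-≤ true  v≤m = v≤m _
if-≤ false _   = z≤n

module ListSum where

  open import Data.List.Membership.Propositional using (_∈_)

  module _ {A : Set} where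

    sum-map-+ : (f g : A → ℕ) (xs : List A) →
                sum (map (λ a → f a + g a) xs) ≡ sum (map f xs) + sum (map g xs)
    sum-map-+ f g []       = refl
    sum-map-+ f g (x ∷ xs) = begin
      f x + g x + sum (map (λ a → f a + g a) xs) ≡⟨ cong (f x + g x +_) (sum-map-+ f g xs) ⟩
      f x + g x + (F + G)                        ≡⟨ +-assoc (f x) (g x) (F + G) ⟩
      f x + (g x + (F + G))                      ≡⟨ cong (f x +_) (sym (+-assoc (g x) F G)) ⟩
      f x + (g x + F + G)                        ≡⟨ cong (λ z → f x + (z + G)) (+-comm (g x) F) ⟩
      f x + (F + g x + G)                        ≡⟨ cong (f x +_) (+-assoc F (g x) G) ⟩
      f x + (F + (g x + G))                      ≡⟨ sym (+-assoc (f x) F (g x + G)) ⟩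
      f x + F + (g x + G)                        ∎
      where
      open ≡-Reasoning
      F = sum (map f xs)
      G = sum (map g xs)

    sum-map-mono-≤ : {f g : A → ℕ} → (∀ a → f a ≤ g a) → (xs : List A) → sum (map f xs) ≤ sum (map g xs)
    sum-map-mono-≤ f≤g []       = z≤n
    sum-map-mono-≤ f≤g (x ∷ xs) = +-mono-≤ (f≤g x) (sum-map-mono-≤ f≤g xs)

    sum-map-≡0 : {f : A → ℕ} (xs : List A) → (∀ {a} → a ∈ xs → f a ≡ 0) → sum (map f xs) ≡ 0
    sum-map-≡0 []       _   = refl
    sum-map-≡0 (x ∷ xs) f≡0 = cong₂ _+_ (f≡0 (here refl)) (sum-map-≡0 xs (f≡0 ∘ there))

    sum-map-≢0 : (f : A → ℕ) (xs : List A) → sum (map f xs) ≢ 0 → ∃[ a ] f a ≢ 0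
    sum-map-≢0 f []       s≢0 = ⊥-elim (s≢0 refl)
    sum-map-≢0 f (x ∷ xs) s≢0 with f x in fx≡
    ... | zero  = sum-map-≢0 f xs s≢0
    ... | suc _ = x , ≡suc⇒≢0 fx≡

    sum-map-≤1 : (f : A → ℕ) {xs : List A} → Unique xs → (∀ a → f a ≤ 1) →
                 (∀ {a a′} → f a ≢ 0 → f a′ ≢ 0 → a ≡ a′) → sum (map f xs) ≤ 1
    sum-map-≤1 f {[]}     _              _   _      = z≤n
    sum-map-≤1 f {x ∷ xs} (x∉xs ∷ uxs) f≤1 single with f x in fx≡ | f≤1 x
    ... | zero        | _      = sum-map-≤1 f uxs f≤1 single
    ... | suc (suc _) | s≤s ()
    ... | suc zero    | _      = ≤-reflexive (cong suc (sum-map-≡0 xs vanishes))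
      where
      vanishes : ∀ {a} → a ∈ xs → f a ≡ 0
      vanishes {a} a∈xs with f a in fa≡
      ... | zero  = refl
      ... | suc _ = ⊥-elim (All.lookup x∉xs a∈xs (single (≡suc⇒≢0 fx≡) (≡suc⇒≢0 fa≡)))

    sum-cartesianProduct : {B : Set} (f : A × B → ℕ) (xs : List A) (ys : List B) →
      sum (map (λ a → sum (map (λ b → f (a , b)) ys)) xs) ≡ sum (map f (cartesianProduct xs ys))
    sum-cartesianProduct f []       ys = refl
    sum-cartesianProduct f (x ∷ xs) ys = begin
      sum (map (λ b → f (x , b)) ys) + sum (map (λ a → sum (map (λ b → f (a , b)) ys)) xs)
        ≡⟨ cong₂ _+_ (cong sum (map-∘ ys)) (sum-cartesianProduct f xs ys) ⟩
      sum (map f (map (x ,_) ys)) + sum (map f (cartesianProduct xs ys))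
        ≡⟨ sym (sum-++ (map f (map (x ,_) ys)) _) ⟩
      sum (map f (map (x ,_) ys) ++ map f (cartesianProduct xs ys))
        ≡⟨ cong sum (sym (map-++ f (map (x ,_) ys) _)) ⟩
      sum (map f (map (x ,_) ys ++ cartesianProduct xs ys))
        ∎
      where open ≡-Reasoning

  module _ {A B : Set} (_≟_ : DecidableEquality B) where

    sum-map-indicator : (k : B) (v : ℕ) {ks : List B} → Unique ks → k ∈ ks →
                        sum (map (λ k′ → if does (k ≟ k′) then v else 0) ks) ≡ v
    sum-map-indicator k v {k ∷ ks} (k∉ks ∷ _) (here refl) with k ≟ k
    ... | yes _   = trans (cong (v +_) (sum-map-≡0 ks absent)) (+-identityʳ v)
      where
      absent : ∀ {k′} → k′ ∈ ks → (if does (k ≟ k′) then v else 0) ≡ 0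
      absent {k′} k′∈ks with k ≟ k′
      ... | yes refl = ⊥-elim (All.lookup k∉ks k′∈ks refl)
      ... | no _     = refl
    ... | no k≢k = ⊥-elim (k≢k refl)
    sum-map-indicator k v {k′ ∷ ks} (k′∉ks ∷ uks) (there k∈ks) with k ≟ k′
    ... | yes refl = ⊥-elim (All.lookup k′∉ks k∈ks refl)
    ... | no _     = sum-map-indicator k v uks k∈ks

    fibre : (c : A → B) (f : A → ℕ) → List A → B → ℕ
    fibre c f xs k = sum (map (λ a → if does (c a ≟ k) then f a else 0) xs)

    sum-map-fibres : (c : A → B) (f : A → ℕ) {ks : List B} → Unique ks → (∀ a → c a ∈ ks) →
                     (xs : List A) → sum (map f xs) ≡ sum (map (fibre c f xs) ks)
    sum-map-fibres c f {ks} uks c∈ks []       = sym (sum-map-≡0 ks (λ _ → refl))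
    sum-map-fibres c f {ks} uks c∈ks (x ∷ xs) = begin
      f x + sum (map f xs)
        ≡⟨ cong₂ _+_ (sym (sum-map-indicator (c x) (f x) uks (c∈ks x))) (sum-map-fibres c f uks c∈ks xs) ⟩
      sum (map (λ k → if does (c x ≟ k) then f x else 0) ks) + sum (map (fibre c f xs) ks)
        ≡⟨ sym (sum-map-+ (λ k → if does (c x ≟ k) then f x else 0) (fibre c f xs) ks) ⟩
      sum (map (fibre c f (x ∷ xs)) ks)
        ∎
      where open ≡-Reasoning

    sum-map-≤-by-charging : (c : A → B) (f : A → ℕ) (g : B → ℕ) {xs : List A} {ks : List B} →
      Unique xs → Unique ks → (∀ a → c a ∈ ks) → (∀ a → f a ≤ 1) →
      (∀ {a a′} → f a ≢ 0 → f a′ ≢ 0 → c a ≡ c a′ → a ≡ a′) →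
      (∀ {a} → f a ≢ 0 → 1 ≤ g (c a)) →
      sum (map f xs) ≤ sum (map g ks)
    sum-map-≤-by-charging c f g {xs} {ks} uxs uks c∈ks f≤1 c-injective g-charged = begin
      sum (map f xs)              ≡⟨ sum-map-fibres c f uks c∈ks xs ⟩
      sum (map (fibre c f xs) ks) ≤⟨ sum-map-mono-≤ fibre≤g ks ⟩
      sum (map g ks)              ∎
      where
      open ≤-Reasoning

      fibre≤1 : ∀ k → fibre c f xs k ≤ 1
      fibre≤1 k = sum-map-≤1 _ uxs (λ a → if-≤ (does (c a ≟ k)) (λ _ → f≤1 a)) single
        where
        single : ∀ {a a′} → (if does (c a ≟ k) then f a else 0) ≢ 0 →
                 (if does (c a′ ≟ k) then f a′ else 0) ≢ 0 → a ≡ a′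
        single {a} {a′} h≢0 h′≢0 with if-≢0 (does (c a ≟ k)) h≢0 | if-≢0 (does (c a′ ≟ k)) h′≢0
        ... | ca≡k , fa≢0 | ca′≡k , fa′≢0 =
          c-injective fa≢0 fa′≢0 (trans (T-does (c a ≟ k) ca≡k) (sym (T-does (c a′ ≟ k) ca′≡k)))

      fibre≤g : ∀ k → fibre c f xs k ≤ g k
      fibre≤g k = ≤1⇒≤ (fibre≤1 k) g≥1
        where
        g≥1 : fibre c f xs k ≢ 0 → 1 ≤ g k
        g≥1 fibre≢0 with sum-map-≢0 _ xs fibre≢0
        ... | a , h≢0 with if-≢0 (does (c a ≟ k)) h≢0
        ... | ca≡k , fa≢0 = subst (λ k′ → 1 ≤ g k′) (T-does (c a ≟ k) ca≡k) (g-charged fa≢0)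

module Position {A : Set} (_≟_ : DecidableEquality A) where

  open import Data.List.Membership.Propositional using (_∈_)

  position : List A → A → ℕ
  position []      v = 0
  position (w ∷ p) v = if does (v ≟ w) then 0 else suc (position p v)

  position-head : ∀ w p → position (w ∷ p) w ≡ 0
  position-head w p with w ≟ w
  ... | yes _   = refl
  ... | no w≢w  = ⊥-elim (w≢w refl)

  position-tail : ∀ {v w} p → v ≢ w → position (w ∷ p) v ≡ suc (position p v)
  position-tail {v} {w} p v≢w with v ≟ w
  ... | yes v≡w = ⊥-elim (v≢w v≡w)
  ... | no _    = refl

  position-injective : ∀ p {u v} → u ∈ p → v ∈ p → position p u ≡ position p v → u ≡ v
  position-injective (w ∷ p) {u} {v} u∈ v∈ eq with u ≟ w | v ≟ w
  ... | yes u≡w | yes v≡w = trans u≡w (sym v≡w)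
  ... | no u≢w  | no v≢w  = position-injective p (Any.tail u≢w u∈) (Any.tail v≢w v∈) (suc-injective eq)
  ... | yes _ | no _ with () ← eq
  ... | no _ | yes _ with () ← eq

  Consecutive⇒∈ˡ : ∀ {p : List A} {u v} → Consecutive p u v → u ∈ p
  Consecutive⇒∈ˡ here      = here refl
  Consecutive⇒∈ˡ (there c) = there (Consecutive⇒∈ˡ c)

  Consecutive⇒∈ʳ : ∀ {p : List A} {u v} → Consecutive p u v → v ∈ p
  Consecutive⇒∈ʳ here      = there (here refl)
  Consecutive⇒∈ʳ (there c) = there (Consecutive⇒∈ʳ c)

  position-Consecutive : ∀ {p u v} → Unique p → Consecutive p u v → position p v ≡ suc (position p u)
  position-Consecutive {u ∷ v ∷ p} {u} {v} (u∉ ∷ _) here = begin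
    position (u ∷ v ∷ p) v ≡⟨ position-tail (v ∷ p) (≢-sym (All.lookup u∉ (here refl))) ⟩
    suc (position (v ∷ p) v) ≡⟨ cong suc (position-head v p) ⟩
    1                        ≡⟨ cong suc (sym (position-head u (v ∷ p))) ⟩
    suc (position (u ∷ v ∷ p) u) ∎
    where open ≡-Reasoning
  position-Consecutive {w ∷ p} {u} {v} (w∉ ∷ up) (there c) = begin
    position (w ∷ p) v     ≡⟨ position-tail p (≢-sym (All.lookup w∉ (Consecutive⇒∈ʳ c))) ⟩
    suc (position p v)     ≡⟨ cong suc (position-Consecutive up c) ⟩
    suc (suc (position p u)) ≡⟨ cong suc (sym (position-tail p (≢-sym (All.lookup w∉ (Consecutive⇒∈ˡ c))))) ⟩
    suc (position (w ∷ p) u) ∎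
    where open ≡-Reasoning

  OnPath⇒∈ˡ : ∀ {p : List A} {u v} → Consecutive p u v ⊎ Consecutive p v u → u ∈ p
  OnPath⇒∈ˡ (inj₁ c) = Consecutive⇒∈ˡ c
  OnPath⇒∈ˡ (inj₂ c) = Consecutive⇒∈ʳ c

  OnPath⇒∈ʳ : ∀ {p : List A} {u v} → Consecutive p u v ⊎ Consecutive p v u → v ∈ p
  OnPath⇒∈ʳ (inj₁ c) = Consecutive⇒∈ʳ c
  OnPath⇒∈ʳ (inj₂ c) = Consecutive⇒∈ˡ c

away : ℕ → ℕ → ℕ
away t m with t ≤? m
... | yes _ = suc m
... | no  _ = m

away-≢ : ∀ t m → away t m ≢ t
away-≢ t m with t ≤? m
... | yes t≤m = λ sm≡t → <-irrefl (sym sm≡t) (s≤s t≤m)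
... | no  t≰m = λ m≡t → <-irrefl m≡t (≰⇒> t≰m)

away-injective : ∀ t {m m′} → away t m ≡ away t m′ → m ≡ m′
away-injective t {m} {m′} eq with t ≤? m | t ≤? m′
... | yes _   | yes _    = suc-injective eq
... | no  _   | no  _    = eq
... | yes t≤m | no  t≰m′ = ⊥-elim (<-asym (<-≤-trans (≰⇒> t≰m′) t≤m) (subst (m <_) eq (n<1+n m)))
... | no  t≰m | yes t≤m′ = ⊥-elim (<-asym (<-≤-trans (≰⇒> t≰m) t≤m′) (subst (m′ <_) (sym eq) (n<1+n m′)))

away-cases : ∀ t m → away t m ≡ m ⊎ away t m ≡ suc m
away-cases t m with t ≤? m
... | yes _ = inj₂ refl
... | no  _ = inj₁ refl

module FartherEndpoint {I : Set} (pos : I → ℕ) (t : ℕ) where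

  Spans : ℕ → I → I → Set
  Spans m i j = (pos i ≡ m × pos j ≡ suc m) ⊎ (pos i ≡ suc m × pos j ≡ m)

  charge : I × I → I
  charge (i , j) with pos i ℕ.≟ away t (pos i ⊓ pos j)
  ... | yes _ = i
  ... | no  _ = j

  charge-endpoint : (P : I → Set) {i j : I} → P i → P j → P (charge (i , j))
  charge-endpoint P {i} {j} Pi Pj with pos i ℕ.≟ away t (pos i ⊓ pos j)
  ... | yes _ = Pi
  ... | no  _ = Pj

  Spans⇒⊓ : ∀ {m i j} → Spans m i j → pos i ⊓ pos j ≡ m
  Spans⇒⊓ {m} (inj₁ (pi≡m , pj≡1+m)) = trans (cong₂ _⊓_ pi≡m pj≡1+m) (m≤n⇒m⊓n≡m (n≤1+n m))
  Spans⇒⊓ {m} (inj₂ (pi≡1+m , pj≡m)) = trans (cong₂ _⊓_ pi≡1+m pj≡m) (m≥n⇒m⊓n≡n (n≤1+n m))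

  Spans⇒away : ∀ {m i j} → Spans m i j → away t m ≡ pos i ⊎ away t m ≡ pos j
  Spans⇒away {m} (inj₁ (pi≡m , pj≡1+m)) with away-cases t m
  ... | inj₁ e = inj₁ (trans e (sym pi≡m))
  ... | inj₂ e = inj₂ (trans e (sym pj≡1+m))
  Spans⇒away {m} (inj₂ (pi≡1+m , pj≡m)) with away-cases t m
  ... | inj₁ e = inj₂ (trans e (sym pj≡m))
  ... | inj₂ e = inj₁ (trans e (sym pi≡1+m))

  pos-charge : ∀ {m i j} → Spans m i j → pos (charge (i , j)) ≡ away t m
  pos-charge {m} {i} {j} sp with pos i ℕ.≟ away t (pos i ⊓ pos j)
  ... | yes pi≡ = trans pi≡ (cong (away t) (Spans⇒⊓ sp))
  ... | no  pi≢ with Spans⇒away sp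
  ...   | inj₁ e = ⊥-elim (pi≢ (trans (sym e) (cong (away t) (sym (Spans⇒⊓ sp)))))
  ...   | inj₂ e = sym e

cust-injective : ∀ {n} {i j : Fin n} → cust {n} i ≡ cust j → i ≡ j
cust-injective = Finₚ.inject₁-injective ∘ Finₚ.suc-injective

cust-mono : ∀ {n} {i j : Fin n} → i Fin.< j → cust {n} i Fin.< cust j
cust-mono {n} {i} {j} i<j rewrite Finₚ.toℕ-inject₁ i | Finₚ.toℕ-inject₁ j = s≤s i<j

cust≢depot′ : ∀ {n} {i : Fin n} → cust i ≢ depot′
cust≢depot′ {n} {i} eq = <-irrefl (cong toℕ eq) cust<depot′
  where
  cust<depot′ : toℕ (cust i) < toℕ (depot′ {n})
  cust<depot′ rewrite Finₚ.toℕ-fromℕ (suc n) | Finₚ.toℕ-inject₁ i = s≤s (Finₚ.toℕ<n i)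

module Charging {n : ℕ} {D : Subset n} {x : Vtx n → Vtx n → ℕ} {y : Vtx n → ℕ}
                (feasible : Feasible n D x y) (S : Subset n) (l : Fin n) where

  open Feasible feasible
  open Position (Fin._≟_ {suc (suc n)})
  open import Data.List.Membership.Propositional using (_∈_)
  open import Data.List.Membership.Propositional.Properties using (∈-++⁻)

  route : List (Vtx n)
  route = depot ∷ interior ++ [ depot′ ]

  place : Fin n → ℕ
  place i = position route (cust i)

  open FartherEndpoint place (place l) public

  Edge : Fin n → Fin n → Set
  Edge i j = OnPath route (cust i) (cust j)

  visited : ∀ {i} → cust i ∈ route → y (cust i) ≡ 1
  visited (here ())
  visited (there i∈) with ∈-++⁻ interior i∈
  ... | inj₁ i∈interior = proj₂ (proj₂ (interior-sound _ i∈interior))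
  ... | inj₂ (here i≡depot′) = ⊥-elim (cust≢depot′ i≡depot′)

  place-injective : ∀ {i j} → cust i ∈ route → cust j ∈ route → place i ≡ place j → i ≡ j
  place-injective i∈ j∈ = cust-injective ∘ position-injective route i∈ j∈

  Edge⇒Spans : ∀ {i j} → Edge i j → ∃[ m ] Spans m i j
  Edge⇒Spans {i}     (inj₁ c) = place i , inj₁ (refl , position-Consecutive simple c)
  Edge⇒Spans {_} {j} (inj₂ c) = place j , inj₂ (position-Consecutive simple c , refl)

  aligned : ∀ {i j i′ j′} → Edge i j → Edge i′ j′ → place i ≡ place i′ → place j ≡ place j′ → (i , j) ≡ (i′ , j′)
  aligned ij i′j′ pi≡ pj≡ = cong₂ _,_ (place-injective (OnPath⇒∈ˡ ij) (OnPath⇒∈ˡ i′j′) pi≡)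
                                     (place-injective (OnPath⇒∈ʳ ij) (OnPath⇒∈ʳ i′j′) pj≡)

  flipped : ∀ {i j i′ j′} → Edge i j → Edge i′ j′ → i Fin.< j → i′ Fin.< j′ →
            place i ≡ place j′ → place j ≡ place i′ → ⊥
  flipped {i} {j} {i′} {j′} ij i′j′ i<j i′<j′ pi≡ pj≡ = Finₚ.<-asym i<j (subst₂ Fin._<_ i′≡j j′≡i i′<j′)
    where
    j′≡i : j′ ≡ i
    j′≡i = place-injective (OnPath⇒∈ʳ i′j′) (OnPath⇒∈ˡ ij) (sym pi≡)
    i′≡j : i′ ≡ j
    i′≡j = place-injective (OnPath⇒∈ˡ i′j′) (OnPath⇒∈ʳ ij) (sym pj≡)

  Spans-unique : ∀ {m i j i′ j′} → Edge i j → Edge i′ j′ → i Fin.< j → i′ Fin.< j′ →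
                 Spans m i j → Spans m i′ j′ → (i , j) ≡ (i′ , j′)
  Spans-unique ij i′j′ _   _     (inj₁ (pi , pj)) (inj₁ (pi′ , pj′)) = aligned ij i′j′ (trans pi (sym pi′)) (trans pj (sym pj′))
  Spans-unique ij i′j′ _   _     (inj₂ (pi , pj)) (inj₂ (pi′ , pj′)) = aligned ij i′j′ (trans pi (sym pi′)) (trans pj (sym pj′))
  Spans-unique ij i′j′ i<j i′<j′ (inj₁ (pi , pj)) (inj₂ (pi′ , pj′)) =
    ⊥-elim (flipped ij i′j′ i<j i′<j′ (trans pi (sym pj′)) (trans pj (sym pi′)))
  Spans-unique ij i′j′ i<j i′<j′ (inj₂ (pi , pj)) (inj₁ (pi′ , pj′)) =
    ⊥-elim (flipped ij i′j′ i<j i′<j′ (trans pi (sym pj′)) (trans pj (sym pi′)))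

  edgeTerm : Fin n × Fin n → ℕ
  edgeTerm (i , j) = if lookup S i ∧ lookup S j ∧ does (i Fin.<? j) then x (cust i) (cust j) else 0

  nodeTerm : Fin n → ℕ
  nodeTerm k = if lookup S k ∧ not (does (k Fin.≟ l)) then y (cust k) else 0

  edge-condition : ∀ {i j} → T (lookup S i ∧ lookup S j ∧ does (i Fin.<? j)) →
                   T (lookup S i) × T (lookup S j) × i Fin.< j
  edge-condition {i} {j} cond =
    let i∈S , cond′ = Equivalence.to T-∧ cond
        j∈S , i<?j  = Equivalence.to T-∧ cond′
    in  i∈S , j∈S , T-does (i Fin.<? j) i<?j

  x≤1 : ∀ {i j} → i Fin.< j → x (cust i) (cust j) ≤ 1
  x≤1 i<j with x-incidence _ _ (cust-mono i<j)
  ... | inj₁ (x≡1 , _) = ≤-reflexive x≡1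
  ... | inj₂ (x≡0 , _) = subst (_≤ 1) (sym x≡0) z≤n

  x⇒Edge : ∀ {i j} → i Fin.< j → x (cust i) (cust j) ≢ 0 → Edge i j
  x⇒Edge i<j x≢0 with x-incidence _ _ (cust-mono i<j)
  ... | inj₁ (_ , edge) = edge
  ... | inj₂ (x≡0 , _)  = ⊥-elim (x≢0 x≡0)

  edgeTerm≤1 : ∀ e → edgeTerm e ≤ 1
  edgeTerm≤1 (i , j) = if-≤ (lookup S i ∧ lookup S j ∧ does (i Fin.<? j)) (x≤1 ∘ proj₂ ∘ proj₂ ∘ edge-condition)

  edgeTerm-support : ∀ {i j} → edgeTerm (i , j) ≢ 0 →
                     T (lookup S i) × T (lookup S j) × i Fin.< j × Edge i j
  edgeTerm-support {i} {j} term≢0 =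
    let cond , x≢0        = if-≢0 (lookup S i ∧ lookup S j ∧ does (i Fin.<? j)) term≢0
        i∈S , j∈S , i<j = edge-condition cond
    in  i∈S , j∈S , i<j , x⇒Edge i<j x≢0

  charge-injective : ∀ {e e′} → edgeTerm e ≢ 0 → edgeTerm e′ ≢ 0 → charge e ≡ charge e′ → e ≡ e′
  charge-injective {i , j} {i′ , j′} term≢0 term′≢0 same-charge
    with edgeTerm-support term≢0 | edgeTerm-support term′≢0
  ... | _ , _ , i<j , ij | _ , _ , i′<j′ , i′j′ with Edge⇒Spans ij | Edge⇒Spans i′j′
  ... | m , sp | m′ , sp′ = Spans-unique ij i′j′ i<j i′<j′ sp (subst (λ k → Spans k i′ j′) (sym m≡m′) sp′)
    where
    m≡m′ : m ≡ m′
    m≡m′ = away-injective (place l)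
             (trans (sym (pos-charge sp)) (trans (cong place same-charge) (pos-charge sp′)))

  nodeTerm≥1 : ∀ {k} → T (lookup S k) → k ≢ l → y (cust k) ≡ 1 → 1 ≤ nodeTerm k
  nodeTerm≥1 {k} k∈S k≢l yk≡1 with lookup S k | k Fin.≟ l
  ... | true | no  _   = ≤-reflexive (sym yk≡1)
  ... | true | yes k≡l = ⊥-elim (k≢l k≡l)

  nodeTerm-charge : ∀ {e} → edgeTerm e ≢ 0 → 1 ≤ nodeTerm (charge e)
  nodeTerm-charge {i , j} term≢0 with edgeTerm-support term≢0
  ... | i∈S , j∈S , _ , ij with Edge⇒Spans ij
  ... | m , sp = nodeTerm≥1 (proj₁ charged) k≢l (proj₂ charged)
    where
    charged : T (lookup S (charge (i , j))) × y (cust (charge (i , j))) ≡ 1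
    charged = charge-endpoint (λ k → T (lookup S k) × y (cust k) ≡ 1)
                (i∈S , visited (OnPath⇒∈ˡ ij)) (j∈S , visited (OnPath⇒∈ʳ ij))
    k≢l : charge (i , j) ≢ l
    k≢l charge≡l = away-≢ (place l) m (trans (sym (pos-charge sp)) (cong place charge≡l))

open import Data.Fin.Subset using (_∈_; ∣_∣)

proposition1 : (n : ℕ) (D : Subset n) (S : Subset n) → 3 ≤ ∣ S ∣ → (l : Fin n) → l ∈ S →
    (x : Vtx n → Vtx n → ℕ) (y : Vtx n → ℕ) → Feasible n D x y →
    edgeSum S x ≤ nodeSumExcept S l y
proposition1 n D S _ l _ x y feasible = begin
  edgeSum S x                                  ≡⟨ sum-cartesianProduct edgeTerm vertices vertices ⟩
  sum (map edgeTerm (cartesianProduct vertices vertices))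
    ≤⟨ sum-map-≤-by-charging Fin._≟_ charge edgeTerm nodeTerm
         (cartesianProduct⁺ (allFin⁺ n) (allFin⁺ n)) (allFin⁺ n) (λ _ → ∈-allFin _)
         edgeTerm≤1 charge-injective nodeTerm-charge ⟩
  nodeSumExcept S l y                          ∎
  where
  open ≤-Reasoning
  open ListSum
  open Charging feasible S l
  vertices : List (Fin n)
  vertices = allFin n
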